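{- Let $q>1$ and $n>1$ be integers, and let $S$ be a special orientable sequence of order $n$ over $\mathbb{Z}_q$ (an $\mathcal{SOS}_q(n)$). Then the period of $S$ is at most: \begin{align*} \frac{q^n-q^{(n+1)/2}-q^{(n-1)/2}+1}{2} &\quad\text{if $q$ and $n$ are both odd;}\\ \frac{q^n-2q^{n/2}+1}{2} &\quad\text{if $q$ is odd and $n$ is even;}\\ \frac{q^n-q^{(n+1)/2}-2q^{(n-1)/2}+2^{(n+3)/2}-2^{(n+1)/2}}{2} &\quad\text{if $q$ is even and $n$ is odd;}\\ \frac{q^n-2q^{n/2}+2^{(n+2)/2}-2^{n/2}}{2} &\quad\text{if $q$ and $n$ are both even.} \end{align*}
   Context: All sequences are periodic with entries in $\mathbb{Z}_q$. For a sequence $S=(s_i)$ of period $m$ write $\mathbf{s}_n(i)=(s_i,s_{i+1},\ldots,s_{i+n-1})$. For an $n$-tuple $\mathbf{u}=(u_0,\ldots,u_{n-1})$, its reverse is $\mathbf{u}^R=(u_{n-1},\ldots,u_0)$ and its negative is $-\mathbf{u}=(-u_0,\ldots,-u_{n-1})$. $S$ is an $n$-window sequence if $\mathbf{s}_n(i)=\mathbf{s}_n(j)$ implies $i\equiv j\pmod m$. An orientable sequence of order $n$ ($\mathcal{OS}_q(n)$) is an $n$-window sequence with $\mathbf{s}_n(i)\neq\mathbf{s}_n(j)^R$ for all $i,j$. A special orientable sequence of order $n$ ($\mathcal{SOS}_q(n)$) is an $\mathcal{OS}_q(n)$ which additionally satisfies $\mathbf{s}_n(i)\neq-\mathbf{s}_n(j)^R$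 for all $i,j$. -}

module Defs where

open import Data.Nat using (ℕ; zero; suc; _+_; _*_; _∸_; _^_; _<_; _≡ᵇ_)
open import Data.Nat.DivMod using (_mod_; _/_; _%_)
open import Data.Fin using (Fin; toℕ)
open import Data.Vec using (Vec; tabulate; reverse; map)
open import Data.Integer as ℤ using (ℤ; +_)
open import Data.Bool using (if_then_else_)
open import Relation.Binary.PropositionalEquality using (_≡_; _≢_)

negFin : ∀ {q} → Fin q → Fin q
negFin {suc q} x = (suc q ∸ toℕ x) mod (suc q)

IsPeriodic : ∀ {q} → (s : ℕ → Fin q) → (m : ℕ) → Set
IsPeriodic s m = (0 < m) × (∀ i → s (i + m) ≡ s i)
  where open import Data.Product using (_×_)

window : ∀ {q} → (s : ℕ → Fin q) → (n i : ℕ) → Vec (Fin q) n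
window s n i = tabulate (λ k → s (i + toℕ k))

_≡_[mod_] : ℕ → ℕ → ℕ → Set
i ≡ j [mod m ] = i % suc (m ∸ 1) ≡ j % suc (m ∸ 1)

IsWindow : ∀ {q} → (s : ℕ → Fin q) → (m n : ℕ) → Set
IsWindow s m n = ∀ i j → window s n i ≡ window s n j → i ≡ j [mod m ]

IsOS : ∀ {q} → (s : ℕ → Fin q) → (m n : ℕ) → Set
IsOS s m n = IsPeriodic s m × IsWindow s m n
           × (∀ i j → window s n i ≢ reverse (window s n j))
  where open import Data.Product using (_×_)

IsSOS : ∀ {q} → (s : ℕ → Fin q) → (m n : ℕ) → Set
IsSOS s m n = IsOS s m n
            × (∀ i j → window s n i ≢ map negFin (reverse (window s n j)))
  where open import Data.Product using (_×_)

-- Twice the bound of Theorem 2.1 (numerators), as an integer.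
-- For odd n: (n+1)/2 = ⌊n/2⌋+1, (n-1)/2 = ⌊n/2⌋, (n+3)/2 = ⌊n/2⌋+2.
-- For even n: n/2 = ⌊n/2⌋, (n+2)/2 = ⌊n/2⌋+1.
twiceBound : ℕ → ℕ → ℤ
twiceBound q n =
  if q % 2 ≡ᵇ 1 then
    (if n % 2 ≡ᵇ 1
      then + (q ^ n) ℤ.- + (q ^ (h + 1)) ℤ.- + (q ^ h) ℤ.+ + 1
      else + (q ^ n) ℤ.- + (2 * q ^ h) ℤ.+ + 1)
  else
    (if n % 2 ≡ᵇ 1
      then + (q ^ n) ℤ.- + (q ^ (h + 1)) ℤ.- + (2 * q ^ h) ℤ.+ + (2 ^ (h + 2)) ℤ.- + (2 ^ (h + 1))
      else + (q ^ n) ℤ.- + (2 * q ^ h) ℤ.+ + (2 ^ (h + 1)) ℤ.- + (2 ^ h))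
  where h = n / 2

module Submission where

-- The m windows of S and their reversals are 2m distinct words of length n, none of which is a
-- palindrome (u = uᴿ) or a negapalindrome (u = −uᴿ); so 2m is at most q^n minus the number of
-- such symmetric words. Write n = 2h + r with r ≤ 1. The palindromes are the words u x uᴿ and
-- the negapalindromes the words u x (−u)ᴿ with −x = x, where |u| = h and |x| = r; a word is of
-- both kinds iff also −u = u. Negation on ℤ_q fixes only 0, or 0 and q/2 when q is even, and
-- counting with these c = 1 or c = 2 self-negative letters gives
-- q^n − 2m ≥ q^h q^r + (q^h − c^h) c^r, which is the bound in each of the four cases.

open import Defs
open import Data.Nat using (ℕ; _<_; _*_)
open import Data.Fin using (Fin)
open import Data.Integer using (+_; _≤_)

open import Algebra.Definitions using (Involutive)
open import Data.Empty using (⊥-elim)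
open import Data.Fin as Fin using (toℕ)
import Data.Fin.Properties as Finₚ
import Data.Integer as ℤ
import Data.Integer.Properties as ℤₚ
import Data.Integer.Tactic.RingSolver as ℤ-Solver
import Data.List as List
open import Data.List
  using (List; []; _∷_; [_]; length; map; reverse; _++_; filter; cartesianProductWith; allFin)
open import Data.List.Membership.Propositional using (_∈_)
open import Data.List.Membership.Propositional.Properties
  using ( ∈-map⁺; ∈-map⁻; ∈-++⁻; ∈-allFin; ∈-filter⁺; ∈-filter⁻
        ; ∈-cartesianProductWith⁺; ∈-cartesianProductWith⁻)
open import Data.List.Properties
  using ( length-++; length-map; length-reverse; length-tabulate; length-removeAt′
        ; ∷-injective; ∷-injectiveˡ; ∷-injectiveʳ; ++-assoc; map-++; map-id; map-∘; map-cong
        ; reverse-++; reverse-map; reverse-involutive; reverse-injective)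
open import Data.List.Relation.Binary.Subset.Propositional using (_⊆_)
open import Data.List.Relation.Unary.All as All using (All; []; _∷_; all?)
open import Data.List.Relation.Unary.Any using (here; there; index; _─_)
open import Data.List.Relation.Unary.Unique.Propositional using (Unique; []; _∷_)
import Data.List.Relation.Unary.Unique.Propositional.Properties as Unique
open import Data.Nat as ℕ using (zero; suc; _+_; _∸_; _^_; _/_; _%_; ⌊_/2⌋; z≤n; s≤s)
open import Data.Nat.DivMod using (m%n<n; m<n⇒m%n≡m; n%n≡0; m≡m%n+[m/n]*n)
open import Data.Nat.Properties
  using ( ≤-antisym; <⇒≤; <⇒≢; m<m+n; m+n≤o⇒m≤o∸n; m+n≤o⇒n≤o; +-suc; +-identityʳ; *-comm
        ; suc-injective; m∸n≤m; m+n∸n≡m; m+[n∸m]≡n; m∸[m∸n]≡n; n≡⌊n+n/2⌋; ^-zeroˡ; ^-distribˡ-+-*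
        ; module ≤-Reasoning)
import Data.Nat.Tactic.RingSolver as ℕ-Solver
open import Data.Product using (_×_; _,_; proj₂)
open import Data.Sum as Sum using (_⊎_; inj₁; inj₂)
open import Data.Vec as Vec using (Vec; []; _∷_; toList)
import Data.Vec.Properties as Vec
open import Data.Vec.Relation.Binary.Equality.Cast using (cast-is-id)
open import Function using (id; _∘_; _⇔_; mk⇔; Equivalence)
open import Relation.Binary.PropositionalEquality
  using (_≡_; _≢_; refl; sym; trans; cong; cong₂; subst; subst₂; module ≡-Reasoning)
open import Relation.Nullary using (¬_; yes; no)
open import Relation.Unary using (Decidable)
open import Relation.Unary.Properties using (∁?)

module _ {A : Set} where

  ∈-─ : ∀ {x y} {xs : List A} (x∈xs : x ∈ xs) → y ∈ xs → y ≢ x → y ∈ (xs ─ x∈xs)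
  ∈-─ (here refl)  (here refl)  y≢x = ⊥-elim (y≢x refl)
  ∈-─ (here refl)  (there y∈xs) _   = y∈xs
  ∈-─ (there _)    (here refl)  _   = here refl
  ∈-─ (there x∈xs) (there y∈xs) y≢x = there (∈-─ x∈xs y∈xs y≢x)

  Unique⇒length≤ : ∀ {xs ys : List A} → Unique xs → xs ⊆ ys → length xs ℕ.≤ length ys
  Unique⇒length≤ [] _ = z≤n
  Unique⇒length≤ {x ∷ xs} {ys} (x∉xs ∷ xs!) xs⊆ys = begin
    suc (length xs)          ≤⟨ s≤s (Unique⇒length≤ xs! xs⊆ys─x) ⟩
    suc (length (ys ─ x∈ys)) ≡⟨ length-removeAt′ ys (index x∈ys) ⟨
    length ys                ∎
    where
    open ≤-Reasoning
    x∈ys = xs⊆ys (here refl)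
    xs⊆ys─x : xs ⊆ (ys ─ x∈ys)
    xs⊆ys─x y∈xs = ∈-─ x∈ys (xs⊆ys (there y∈xs)) (λ y≡x → All.lookup x∉xs y∈xs (sym y≡x))

  Unique⇒length≡ : ∀ {xs ys : List A} → Unique xs → Unique ys → xs ⊆ ys → ys ⊆ xs →
                   length xs ≡ length ys
  Unique⇒length≡ xs! ys! xs⊆ys ys⊆xs =
    ≤-antisym (Unique⇒length≤ xs! xs⊆ys) (Unique⇒length≤ ys! ys⊆xs)

  ++-injective : ∀ (xs ys : List A) {zs ws} → length xs ≡ length ys → xs ++ zs ≡ ys ++ ws →
                 xs ≡ ys × zs ≡ ws
  ++-injective []       []       _   eq = refl , eq
  ++-injective (x ∷ xs) (y ∷ ys) len eq
    with refl , eq′   ← ∷-injective eq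
    with refl , zs≡ws ← ++-injective xs ys (suc-injective len) eq′
    = refl , zs≡ws

  length-filter+length-filter-∁ : ∀ {P : A → Set} (P? : Decidable P) xs →
                                  length (filter P? xs) + length (filter (∁? P?) xs) ≡ length xs
  length-filter+length-filter-∁ P? []       = refl
  length-filter+length-filter-∁ P? (x ∷ xs) with P? x
  ... | yes _ = cong suc (length-filter+length-filter-∁ P? xs)
  ... | no  _ = trans (+-suc _ _) (cong suc (length-filter+length-filter-∁ P? xs))

  map-id-local⁻ : ∀ {f : A → A} {xs} → map f xs ≡ xs → All (λ x → f x ≡ x) xs
  map-id-local⁻ {xs = []}    _  = []
  map-id-local⁻ {xs = _ ∷ _} eq = ∷-injectiveˡ eq ∷ map-id-local⁻ (∷-injectiveʳ eq)

length-allFin : ∀ n → length (allFin n) ≡ n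
length-allFin n = length-tabulate id

length-cartesianProductWith : ∀ {A B C : Set} (f : A → B → C) xs ys →
                              length (cartesianProductWith f xs ys) ≡ length xs * length ys
length-cartesianProductWith f []       ys = refl
length-cartesianProductWith f (x ∷ xs) ys = begin
  length (map (f x) ys ++ cartesianProductWith f xs ys)         ≡⟨ length-++ (map (f x) ys) ⟩
  length (map (f x) ys) + length (cartesianProductWith f xs ys) ≡⟨ cong₂ _+_ (length-map (f x) ys)
                                                                     (length-cartesianProductWith f xs ys) ⟩
  length ys + length xs * length ys                            ∎
  where open ≡-Reasoning

module _ {A : Set} where

  toList-injective : ∀ {n} {u v : Vec A n} → toList u ≡ toList v → u ≡ v
  toList-injective {u = u} {v} eq = trans (sym (cast-is-id refl u)) (Vec.toList-injective refl u v eq)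

  vectors : List A → (n : ℕ) → List (Vec A n)
  vectors xs zero    = [ [] ]
  vectors xs (suc n) = cartesianProductWith _∷_ xs (vectors xs n)

  length-vectors : ∀ xs n → length (vectors xs n) ≡ length xs ^ n
  length-vectors xs zero    = refl
  length-vectors xs (suc n) = trans (length-cartesianProductWith _∷_ xs (vectors xs n))
                                    (cong (length xs *_) (length-vectors xs n))

  vectors⁺ : ∀ {xs} n → Unique xs → Unique (vectors xs n)
  vectors⁺ zero    _   = [] ∷ []
  vectors⁺ (suc n) xs! = Unique.cartesianProductWith⁺ _∷_ Vec.∷-injective xs! (vectors⁺ n xs!)

  ∈-vectors⁺ : ∀ {xs n} (v : Vec A n) → All (_∈ xs) (toList v) → v ∈ vectors xs n
  ∈-vectors⁺ []      []            = here refl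
  ∈-vectors⁺ (x ∷ v) (x∈xs ∷ v⊆xs) = ∈-cartesianProductWith⁺ _∷_ x∈xs (∈-vectors⁺ v v⊆xs)

  ∈-vectors⁻ : ∀ xs n {v : Vec A n} → v ∈ vectors xs n → All (_∈ xs) (toList v)
  ∈-vectors⁻ xs zero    (here refl) = []
  ∈-vectors⁻ xs (suc n) v∈
    with _ , _ , x∈xs , w∈ , refl ← ∈-cartesianProductWith⁻ _∷_ xs (vectors xs n) v∈
    = x∈xs ∷ ∈-vectors⁻ xs n w∈

module _ {A : Set} where

  Palindromic : (A → A) → List A → Set
  Palindromic g l = map g (reverse l) ≡ l

  Palindromic-reverse⁻ : ∀ g l → Palindromic g (reverse l) → Palindromic g l
  Palindromic-reverse⁻ g l pal = begin
    map g (reverse l)                     ≡⟨ reverse-map g l ⟩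
    reverse (map g l)                     ≡⟨ cong (reverse ∘ map g) (reverse-involutive l) ⟨
    reverse (map g (reverse (reverse l))) ≡⟨ cong reverse pal ⟩
    reverse (reverse l)                   ≡⟨ reverse-involutive l ⟩
    l                                     ∎
    where open ≡-Reasoning

  short-palindromic : ∀ g {r} (x : Vec A r) → r ℕ.≤ 1 → All (λ a → g a ≡ a) (toList x) →
                      Palindromic g (toList x)
  short-palindromic g []          _        []          = refl
  short-palindromic g (a ∷ [])    _        (ga≡a ∷ []) = cong [_] ga≡a
  short-palindromic g (_ ∷ _ ∷ _) (s≤s ()) _

  mirror : (A → A) → List A → List A → List A
  mirror g u x = u ++ x ++ reverse (map g u)

  length-mirror : ∀ g u x → length (mirror g u x) ≡ length u + (length x + length u)
  length-mirror g u x = begin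
    length (u ++ x ++ reverse (map g u))               ≡⟨ length-++ u ⟩
    length u + length (x ++ reverse (map g u))         ≡⟨ cong (λ k → length u + k) (length-++ x) ⟩
    length u + (length x + length (reverse (map g u))) ≡⟨ cong (λ k → length u + (length x + k))
                                                             (trans (length-reverse (map g u)) (length-map g u)) ⟩
    length u + (length x + length u)                   ∎
    where open ≡-Reasoning

  reverse-mirror : ∀ g u x → reverse (mirror g u x) ≡ map g u ++ reverse x ++ reverse u
  reverse-mirror g u x = begin
    reverse (u ++ x ++ reverse (map g u))                   ≡⟨ reverse-++ u _ ⟩
    reverse (x ++ reverse (map g u)) ++ reverse u           ≡⟨ cong (_++ reverse u) (reverse-++ x _) ⟩
    (reverse (reverse (map g u)) ++ reverse x) ++ reverse u ≡⟨ cong (λ v → (v ++ reverse x) ++ reverse u)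
                                                                 (reverse-involutive (map g u)) ⟩
    (map g u ++ reverse x) ++ reverse u                     ≡⟨ ++-assoc (map g u) (reverse x) (reverse u) ⟩
    map g u ++ reverse x ++ reverse u                       ∎
    where open ≡-Reasoning

  mirror-palindromic : ∀ {g} → Involutive _≡_ g → ∀ u {x} → Palindromic g x → Palindromic g (mirror g u x)
  mirror-palindromic {g} g-involutive u {x} x-pal = begin
    map g (reverse (mirror g u x))                    ≡⟨ cong (map g) (reverse-mirror g u x) ⟩
    map g (map g u ++ reverse x ++ reverse u)         ≡⟨ map-++ g (map g u) _ ⟩
    map g (map g u) ++ map g (reverse x ++ reverse u) ≡⟨ cong₂ _++_ map-g-g (map-++ g (reverse x) (reverse u)) ⟩
    u ++ map g (reverse x) ++ map g (reverse u)       ≡⟨ cong₂ (λ v w → u ++ v ++ w) x-pal (reverse-map g u) ⟩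
    u ++ x ++ reverse (map g u)                       ∎
    where
    open ≡-Reasoning
    map-g-g : map g (map g u) ≡ u
    map-g-g = trans (sym (map-∘ u)) (trans (map-cong g-involutive u) (map-id u))

  mirror-injective : ∀ g g′ {u u′ x x′} → length u ≡ length u′ → length x ≡ length x′ →
                     mirror g u x ≡ mirror g′ u′ x′ → u ≡ u′ × x ≡ x′ × map g u ≡ map g′ u′
  mirror-injective g g′ {u} {u′} {x} {x′} |u|≡|u′| |x|≡|x′| eq
    with refl , eq′  ← ++-injective u u′ |u|≡|u′| eq
    with refl , eq′′ ← ++-injective x x′ |x|≡|x′| eq′
    = refl , refl , reverse-injective eq′′

  mirrorVec : ∀ {h r} → (A → A) → Vec A h → Vec A r → List A
  mirrorVec g u x = mirror g (toList u) (toList x)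

  length-mirrorVec : ∀ g {h r} (u : Vec A h) (x : Vec A r) → length (mirrorVec g u x) ≡ h + (r + h)
  length-mirrorVec g u x = trans (length-mirror g (toList u) (toList x))
    (cong₂ (λ a b → a + (b + a)) (Vec.length-toList u) (Vec.length-toList x))

  mirrorVec-injective : ∀ g g′ {h r} {u u′ : Vec A h} {x x′ : Vec A r} →
                        mirrorVec g u x ≡ mirrorVec g′ u′ x′ →
                        u ≡ u′ × x ≡ x′ × map g (toList u) ≡ map g′ (toList u′)
  mirrorVec-injective g g′ {u = u} {u′} {x} {x′} eq =
    let u≡u′ , x≡x′ , gu≡g′u′ = mirror-injective g g′ (|toList| u u′) (|toList| x x′) eq
    in toList-injective u≡u′ , toList-injective x≡x′ , gu≡g′u′
    where
    |toList| : ∀ {k} (v v′ : Vec A k) → length (toList v) ≡ length (toList v′)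
    |toList| v v′ = trans (Vec.length-toList v) (sym (Vec.length-toList v′))

module _ {A : Set} {m : ℕ} (w : Fin m → List A) where

  wordsAndReversals : List (List A)
  wordsAndReversals = map w (allFin m) ++ map (reverse ∘ w) (allFin m)

  length-wordsAndReversals : length wordsAndReversals ≡ m + m
  length-wordsAndReversals = begin
    length (map w (allFin m) ++ map (reverse ∘ w) (allFin m))         ≡⟨ length-++ (map w (allFin m)) ⟩
    length (map w (allFin m)) + length (map (reverse ∘ w) (allFin m)) ≡⟨ cong₂ _+_
      (trans (length-map w (allFin m)) (length-allFin m))
      (trans (length-map (reverse ∘ w) (allFin m)) (length-allFin m)) ⟩
    m + m                                                             ∎
    where open ≡-Reasoning

  wordsAndReversals-∀ : ∀ {P : List A → Set} → (∀ i → P (w i)) → (∀ i → P (reverse (w i))) →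
                        ∀ {l} → l ∈ wordsAndReversals → P l
  wordsAndReversals-∀ P-w P-reverse-w l∈ with ∈-++⁻ (map w (allFin m)) l∈
  ... | inj₁ l∈w with _ , _ , refl ← ∈-map⁻ w l∈w             = P-w _
  ... | inj₂ l∈r with _ , _ , refl ← ∈-map⁻ (reverse ∘ w) l∈r = P-reverse-w _

  wordsAndReversals⁺ : (∀ {i j} → w i ≡ w j → i ≡ j) → (∀ i j → w i ≢ reverse (w j)) →
                       Unique wordsAndReversals
  wordsAndReversals⁺ w-injective w-orientable =
    Unique.++⁺ (Unique.map⁺ w-injective (Unique.allFin⁺ m))
               (Unique.map⁺ (w-injective ∘ reverse-injective) (Unique.allFin⁺ m))
               disjoint
    where
    disjoint : ∀ {l} → ¬ (l ∈ map w (allFin m) × l ∈ map (reverse ∘ w) (allFin m))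
    disjoint (l∈w , l∈r) with i , _ , refl ← ∈-map⁻ w l∈w | j , _ , eq ← ∈-map⁻ (reverse ∘ w) l∈r
      = w-orientable i j eq

module _ {q : ℕ} where

  allVectors : (n : ℕ) → List (Vec (Fin q) n)
  allVectors = vectors (allFin q)

  ∈-allVectors : ∀ {n} (v : Vec (Fin q) n) → v ∈ allVectors n
  ∈-allVectors v = ∈-vectors⁺ v (All.universal ∈-allFin (toList v))

  allVectors⁺ : ∀ n → Unique (allVectors n)
  allVectors⁺ n = vectors⁺ n (Unique.allFin⁺ q)

  length-allVectors : ∀ n → length (allVectors n) ≡ q ^ n
  length-allVectors n = trans (length-vectors (allFin q) n) (cong (_^ n) (length-allFin q))

  length≤q^n : ∀ {n} {L : List (List (Fin q))} → Unique L → (∀ {l} → l ∈ L → length l ≡ n) →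
               length L ℕ.≤ q ^ n
  length≤q^n {n} {L} L! |L|≡n = begin
    length L                         ≤⟨ Unique⇒length≤ L! L⊆words ⟩
    length (map toList (allVectors n)) ≡⟨ length-map toList (allVectors n) ⟩
    length (allVectors n)            ≡⟨ length-allVectors n ⟩
    q ^ n                            ∎
    where
    open ≤-Reasoning
    ∈-words : ∀ l → l ∈ map toList (allVectors (length l))
    ∈-words l = subst (_∈ map toList (allVectors (length l))) (Vec.toList∘fromList l)
                      (∈-map⁺ toList (∈-allVectors (Vec.fromList l)))
    L⊆words : L ⊆ map toList (allVectors n)
    L⊆words {l} l∈ = subst (λ k → l ∈ map toList (allVectors k)) (|L|≡n l∈) (∈-words l)

module _ {q : ℕ} (f : Fin q → Fin q) where

  fixed? : Decidable (λ a → f a ≡ a)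
  fixed? a = f a Finₚ.≟ a

  fixedPoints : List (Fin q)
  fixedPoints = filter fixed? (allFin q)

  fixedPoints⁺ : Unique fixedPoints
  fixedPoints⁺ = Unique.filter⁺ fixed? (Unique.allFin⁺ q)

  ∈-fixedPoints⁺ : ∀ {a} → f a ≡ a → a ∈ fixedPoints
  ∈-fixedPoints⁺ {a} = ∈-filter⁺ fixed? (∈-allFin a)

  ∈-fixedPoints⁻ : ∀ {a} → a ∈ fixedPoints → f a ≡ a
  ∈-fixedPoints⁻ a∈ = proj₂ (∈-filter⁻ fixed? {xs = allFin q} a∈)

  fixedVector? : ∀ {h} → Decidable (λ (u : Vec (Fin q) h) → All (λ a → f a ≡ a) (toList u))
  fixedVector? = all? fixed? ∘ toList

  unfixedVectors : (h : ℕ) → List (Vec (Fin q) h)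
  unfixedVectors h = filter (∁? fixedVector?) (allVectors h)

  length-unfixedVectors : ∀ h → length fixedPoints ^ h + length (unfixedVectors h) ≡ q ^ h
  length-unfixedVectors h = begin
    length fixedPoints ^ h + length (unfixedVectors h)
      ≡⟨ cong (_+ length (unfixedVectors h)) (trans (sym (length-vectors fixedPoints h)) |fixed|) ⟩
    length (filter fixedVector? (allVectors h)) + length (unfixedVectors h)
      ≡⟨ length-filter+length-filter-∁ fixedVector? (allVectors h) ⟩
    length (allVectors h)
      ≡⟨ length-allVectors h ⟩
    q ^ h ∎
    where
    open ≡-Reasoning
    |fixed| : length (vectors fixedPoints h) ≡ length (filter fixedVector? (allVectors h))
    |fixed| = Unique⇒length≡ (vectors⁺ h fixedPoints⁺) (Unique.filter⁺ fixedVector? (allVectors⁺ h))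
      (λ {u} u∈ → ∈-filter⁺ fixedVector? (∈-allVectors u)
                    (All.map ∈-fixedPoints⁻ (∈-vectors⁻ fixedPoints h u∈)))
      (λ {u} u∈ → ∈-vectors⁺ u (All.map ∈-fixedPoints⁺
                    (proj₂ (∈-filter⁻ fixedVector? {xs = allVectors h} u∈))))

  Symmetric : List (Fin q) → Set
  Symmetric l = Palindromic id l ⊎ Palindromic f l

  Symmetric-reverse⁻ : ∀ l → Symmetric (reverse l) → Symmetric l
  Symmetric-reverse⁻ l = Sum.map (Palindromic-reverse⁻ id l) (Palindromic-reverse⁻ f l)

  -- The palindromes u x uᴿ, followed by the f-palindromes u x (f u)ᴿ that are not palindromes,
  -- i.e. those with f u ≠ u.
  palindromes twistedPalindromes symmetricWords : (h r : ℕ) → List (List (Fin q))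
  palindromes        h r = cartesianProductWith (mirrorVec id) (allVectors h) (allVectors r)
  twistedPalindromes h r = cartesianProductWith (mirrorVec f) (unfixedVectors h) (vectors fixedPoints r)
  symmetricWords     h r = palindromes h r ++ twistedPalindromes h r

  length-symmetricWords : ∀ h r → length (symmetricWords h r) ≡
                          q ^ h * q ^ r + length (unfixedVectors h) * length fixedPoints ^ r
  length-symmetricWords h r = begin
    length (palindromes h r ++ twistedPalindromes h r)
      ≡⟨ length-++ (palindromes h r) ⟩
    length (palindromes h r) + length (twistedPalindromes h r)
      ≡⟨ cong₂ _+_ (length-cartesianProductWith (mirrorVec id) (allVectors h) (allVectors r))
                   (length-cartesianProductWith (mirrorVec f) (unfixedVectors h) (vectors fixedPoints r)) ⟩
    length (allVectors h) * length (allVectors r) + length (unfixedVectors h) * length (vectors fixedPoints r)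
      ≡⟨ cong₂ (λ a b → a + length (unfixedVectors h) * b)
               (cong₂ _*_ (length-allVectors h) (length-allVectors r)) (length-vectors fixedPoints r) ⟩
    q ^ h * q ^ r + length (unfixedVectors h) * length fixedPoints ^ r ∎
    where open ≡-Reasoning

  symmetricWords⁺ : ∀ h r → Unique (symmetricWords h r)
  symmetricWords⁺ h r = Unique.++⁺
    (Unique.cartesianProductWith⁺ (mirrorVec id) (injective id) (allVectors⁺ h) (allVectors⁺ r))
    (Unique.cartesianProductWith⁺ (mirrorVec f) (injective f)
      (Unique.filter⁺ (∁? fixedVector?) (allVectors⁺ h)) (vectors⁺ r fixedPoints⁺))
    disjoint
    where
    injective : ∀ g {u u′ : Vec (Fin q) h} {x x′ : Vec (Fin q) r} →
                mirrorVec g u x ≡ mirrorVec g u′ x′ → u ≡ u′ × x ≡ x′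
    injective g eq = let u≡u′ , x≡x′ , _ = mirrorVec-injective g g eq in u≡u′ , x≡x′
    disjoint : ∀ {l} → ¬ (l ∈ palindromes h r × l ∈ twistedPalindromes h r)
    disjoint (l∈pal , l∈twisted)
      with u , x , _ , _ , refl ← ∈-cartesianProductWith⁻ (mirrorVec id) (allVectors h) _ l∈pal
         | u′ , x′ , u′∈ , _ , eq ← ∈-cartesianProductWith⁻ (mirrorVec f) (unfixedVectors h) _ l∈twisted
      with refl , _ , u≡fu ← mirrorVec-injective id f {u = u} {u′} {x} {x′} eq
      = proj₂ (∈-filter⁻ (∁? fixedVector?) {xs = allVectors h} u′∈)
              (map-id-local⁻ (sym (trans (sym (map-id (toList u))) u≡fu)))

  symmetricWords-symmetric : Involutive _≡_ f → ∀ h {r} → r ℕ.≤ 1 →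
                             ∀ {l} → l ∈ symmetricWords h r → Symmetric l
  symmetricWords-symmetric f-involutive h {r} r≤1 l∈ with ∈-++⁻ (palindromes h r) l∈
  ... | inj₁ l∈pal
    with u , x , _ , _ , refl ← ∈-cartesianProductWith⁻ (mirrorVec id) (allVectors h) _ l∈pal
    = inj₁ (mirror-palindromic (λ _ → refl) (toList u)
             (short-palindromic id x r≤1 (All.universal (λ _ → refl) (toList x))))
  ... | inj₂ l∈twisted
    with u , x , _ , x∈ , refl ← ∈-cartesianProductWith⁻ (mirrorVec f) (unfixedVectors h) _ l∈twisted
    = inj₂ (mirror-palindromic f-involutive (toList u)
             (short-palindromic f x r≤1 (All.map ∈-fixedPoints⁻ (∈-vectors⁻ fixedPoints r x∈))))

  symmetricWords-length : ∀ h r {l} → l ∈ symmetricWords h r → length l ≡ h + (r + h)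
  symmetricWords-length h r l∈ with ∈-++⁻ (palindromes h r) l∈
  ... | inj₁ l∈pal
    with u , x , _ , _ , refl ← ∈-cartesianProductWith⁻ (mirrorVec id) (allVectors h) _ l∈pal
    = length-mirrorVec id u x
  ... | inj₂ l∈twisted
    with u , x , _ , _ , refl ← ∈-cartesianProductWith⁻ (mirrorVec f) (unfixedVectors h) _ l∈twisted
    = length-mirrorVec f u x

  symmetricWords-bound : Involutive _≡_ f → ∀ h {r} → r ℕ.≤ 1 → ∀ {W} → Unique W →
                         (∀ {l} → l ∈ W → length l ≡ h + (r + h)) → (∀ {l} → l ∈ W → ¬ Symmetric l) →
                         length W + length (symmetricWords h r) ℕ.≤ q ^ (h + (r + h))
  symmetricWords-bound f-involutive h {r} r≤1 {W} W! |W| W-asymmetric =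
    subst (ℕ._≤ q ^ (h + (r + h))) (length-++ W)
      (length≤q^n (Unique.++⁺ W! (symmetricWords⁺ h r) disjoint) |W++S|)
    where
    disjoint : ∀ {l} → ¬ (l ∈ W × l ∈ symmetricWords h r)
    disjoint (l∈W , l∈S) = W-asymmetric l∈W (symmetricWords-symmetric f-involutive h r≤1 l∈S)
    |W++S| : ∀ {l} → l ∈ W ++ symmetricWords h r → length l ≡ h + (r + h)
    |W++S| l∈ with ∈-++⁻ W l∈
    ... | inj₁ l∈W = |W| l∈W
    ... | inj₂ l∈S = symmetricWords-length h r l∈S

module _ {q : ℕ} (s : ℕ → Fin q) (m n : ℕ) where

  windowWord : Fin m → List (Fin q)
  windowWord i = toList (window s n (toℕ i))

  windowWord-injective : IsWindow s m n → ∀ {i j} → windowWord i ≡ windowWord j → i ≡ j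
  windowWord-injective distinct {i} {j} eq = Finₚ.toℕ-injective (begin
    toℕ i               ≡⟨ toℕ-mod i ⟨
    toℕ i % suc (m ∸ 1) ≡⟨ distinct (toℕ i) (toℕ j) (toList-injective eq) ⟩
    toℕ j % suc (m ∸ 1) ≡⟨ toℕ-mod j ⟩
    toℕ j               ∎)
    where
    open ≡-Reasoning
    toℕ-mod : ∀ {m} (i : Fin m) → toℕ i % suc (m ∸ 1) ≡ toℕ i
    toℕ-mod {suc _} i = m<n⇒m%n≡m (Finₚ.toℕ<n i)

  windowWord-orientable : (∀ i j → window s n i ≢ Vec.reverse (window s n j)) →
                          ∀ i j → windowWord i ≢ reverse (windowWord j)
  windowWord-orientable orientable i j eq = orientable (toℕ i) (toℕ j)
    (toList-injective (trans eq (sym (Vec.toList-reverse (window s n (toℕ j))))))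

  windowWord-special : ∀ g → (∀ i j → window s n i ≢ Vec.map g (Vec.reverse (window s n j))) →
                       ∀ i j → windowWord i ≢ map g (reverse (windowWord j))
  windowWord-special g special i j eq = special (toℕ i) (toℕ j) (toList-injective (begin
    toList (window s n (toℕ i))                           ≡⟨ eq ⟩
    map g (reverse (toList (window s n (toℕ j))))         ≡⟨ cong (map g) (Vec.toList-reverse (window s n (toℕ j))) ⟨
    map g (toList (Vec.reverse (window s n (toℕ j))))     ≡⟨ Vec.toList-map g (Vec.reverse (window s n (toℕ j))) ⟨
    toList (Vec.map g (Vec.reverse (window s n (toℕ j)))) ∎))
    where open ≡-Reasoning

  module _ (f : Fin q → Fin q)
           (orientable : ∀ i j → window s n i ≢ Vec.reverse (window s n j))
           (special : ∀ i j → window s n i ≢ Vec.map f (Vec.reverse (window s n j))) where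

    windowWord-asymmetric : ∀ i → ¬ Symmetric f (windowWord i)
    windowWord-asymmetric i (inj₁ pal) =
      windowWord-orientable orientable i i (sym (trans (sym (map-id (reverse (windowWord i)))) pal))
    windowWord-asymmetric i (inj₂ pal) = windowWord-special f special i i (sym pal)

    windows-bound : Involutive _≡_ f → IsWindow s m n → ∀ h {r} → r ℕ.≤ 1 → n ≡ h + (r + h) →
                    m + m + length (symmetricWords f h r) ℕ.≤ q ^ n
    windows-bound f-involutive distinct h {r} r≤1 n≡h+[r+h] =
      subst₂ ℕ._≤_ (cong (_+ _) (length-wordsAndReversals windowWord)) (cong (q ^_) (sym n≡h+[r+h]))
        (symmetricWords-bound f f-involutive h r≤1
          (wordsAndReversals⁺ windowWord (windowWord-injective distinct) (windowWord-orientable orientable))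
          (wordsAndReversals-∀ windowWord |w| (λ i → trans (length-reverse (windowWord i)) (|w| i)))
          (wordsAndReversals-∀ windowWord windowWord-asymmetric
            (λ i → windowWord-asymmetric i ∘ Symmetric-reverse⁻ f (windowWord i))))
      where
      |w| : ∀ i → length (windowWord i) ≡ h + (r + h)
      |w| i = trans (Vec.length-toList (window s n (toℕ i))) n≡h+[r+h]

double-%2 : ∀ t → (t + t) % 2 ≡ 0
double-%2 zero    = refl
double-%2 (suc t) rewrite +-suc t t = double-%2 t

double-injective : ∀ {s t} → s + s ≡ t + t → s ≡ t
double-injective {s} {t} eq = trans (n≡⌊n+n/2⌋ s) (trans (cong ⌊_/2⌋ eq) (sym (n≡⌊n+n/2⌋ t)))

module _ {k : ℕ} where

  private
    Q = suc k

  toℕ-negFin : (x : Fin Q) → toℕ (negFin x) ≡ (Q ∸ toℕ x) % Q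
  toℕ-negFin x = Finₚ.toℕ-fromℕ< _

  Q∸suc%Q : ∀ t → (Q ∸ suc t) % Q ≡ k ∸ t
  Q∸suc%Q t = m<n⇒m%n≡m (s≤s (m∸n≤m k t))

  negFin-involutive : Involutive _≡_ (negFin {Q})
  negFin-involutive x = Finₚ.toℕ-injective (begin
    toℕ (negFin (negFin x))       ≡⟨ toℕ-negFin (negFin x) ⟩
    (Q ∸ toℕ (negFin x)) % Q      ≡⟨ cong (λ y → (Q ∸ y) % Q) (toℕ-negFin x) ⟩
    (Q ∸ (Q ∸ toℕ x) % Q) % Q     ≡⟨ neg-neg (toℕ x) (Finₚ.toℕ<n x) ⟩
    toℕ x                         ∎)
    where
    open ≡-Reasoning
    neg-neg : ∀ t → t < Q → (Q ∸ (Q ∸ t) % Q) % Q ≡ t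
    neg-neg zero    _   = trans (cong (λ y → (Q ∸ y) % Q) (n%n≡0 Q)) (n%n≡0 Q)
    neg-neg (suc t) t<Q rewrite Q∸suc%Q t | m∸[m∸n]≡n (<⇒≤ t<Q) = m<n⇒m%n≡m t<Q

  negFin-fixed⇔ : (x : Fin Q) → negFin x ≡ x ⇔ (toℕ x ≡ 0 ⊎ toℕ x + toℕ x ≡ Q)
  negFin-fixed⇔ x = mk⇔
    (λ eq → to (toℕ x) (Finₚ.toℕ<n x) (trans (sym (toℕ-negFin x)) (cong toℕ eq)))
    (λ x-fixed → Finₚ.toℕ-injective (trans (toℕ-negFin x) (from (toℕ x) (Finₚ.toℕ<n x) x-fixed)))
    where
    to : ∀ t → t < Q → (Q ∸ t) % Q ≡ t → t ≡ 0 ⊎ t + t ≡ Q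
    to zero    _   _  = inj₁ refl
    to (suc t) t<Q eq = inj₂ (begin
      suc t + suc t       ≡⟨ cong (λ y → suc t + y) (trans (sym eq) (Q∸suc%Q t)) ⟩
      suc t + (Q ∸ suc t) ≡⟨ m+[n∸m]≡n (<⇒≤ t<Q) ⟩
      Q                   ∎)
      where open ≡-Reasoning
    from : ∀ t → t < Q → t ≡ 0 ⊎ t + t ≡ Q → (Q ∸ t) % Q ≡ t
    from _ _   (inj₁ refl) = n%n≡0 Q
    from t t<Q (inj₂ eq)   = begin
      (Q ∸ t) % Q     ≡⟨ cong (λ y → (y ∸ t) % Q) eq ⟨
      (t + t ∸ t) % Q ≡⟨ cong (_% Q) (m+n∸n≡m t t) ⟩
      t % Q           ≡⟨ m<n⇒m%n≡m t<Q ⟩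
      t               ∎
      where open ≡-Reasoning

  ∈-fixedPoints-negFin⁻ : ∀ {x} → x ∈ fixedPoints (negFin {Q}) → toℕ x ≡ 0 ⊎ toℕ x + toℕ x ≡ Q
  ∈-fixedPoints-negFin⁻ {x} x∈ = Equivalence.to (negFin-fixed⇔ x) (∈-fixedPoints⁻ negFin x∈)

  length-fixedPoints-negFin-odd : Q % 2 ≡ 1 → length (fixedPoints (negFin {Q})) ≡ 1
  length-fixedPoints-negFin-odd Q-odd = Unique⇒length≡ (fixedPoints⁺ negFin) ([] ∷ []) sub sup
    where
    sub : fixedPoints negFin ⊆ [ Fin.zero ]
    sub {x} x∈ with ∈-fixedPoints-negFin⁻ x∈
    ... | inj₁ x≡0   = here (Finₚ.toℕ-injective x≡0)
    ... | inj₂ x+x≡Q with () ← trans (sym (double-%2 (toℕ x))) (trans (cong (_% 2) x+x≡Q) Q-odd)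
    sup : [ Fin.zero ] ⊆ fixedPoints negFin
    sup (here refl) = ∈-fixedPoints⁺ negFin (Equivalence.from (negFin-fixed⇔ Fin.zero) (inj₁ refl))

  length-fixedPoints-negFin-even : Q % 2 ≡ 0 → length (fixedPoints (negFin {Q})) ≡ 2
  length-fixedPoints-negFin-even Q-even =
    Unique⇒length≡ (fixedPoints⁺ negFin) ((zero≢half ∷ []) ∷ [] ∷ []) sub sup
    where
    a = Q / 2
    Q≡a+a : Q ≡ a + a
    Q≡a+a = begin
      Q             ≡⟨ m≡m%n+[m/n]*n Q 2 ⟩
      Q % 2 + a * 2 ≡⟨ cong₂ _+_ Q-even (*-comm a 2) ⟩
      a + (a + 0)   ≡⟨ cong (λ y → a + y) (+-identityʳ a) ⟩
      a + a         ∎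
      where open ≡-Reasoning
    0<a : 0 < a
    0<a with a | Q≡a+a
    ... | suc _ | _ = s≤s z≤n
    half : Fin Q
    half = Fin.fromℕ< (subst (a <_) (sym Q≡a+a) (m<m+n a 0<a))
    toℕ-half : toℕ half ≡ a
    toℕ-half = Finₚ.toℕ-fromℕ< _
    zero≢half : Fin.zero ≢ half
    zero≢half eq = <⇒≢ 0<a (trans (cong toℕ eq) toℕ-half)
    sub : fixedPoints negFin ⊆ Fin.zero ∷ half ∷ []
    sub {x} x∈ with ∈-fixedPoints-negFin⁻ x∈
    ... | inj₁ x≡0   = here (Finₚ.toℕ-injective x≡0)
    ... | inj₂ x+x≡Q = there (here (Finₚ.toℕ-injective
                         (trans (double-injective (trans x+x≡Q Q≡a+a)) (sym toℕ-half))))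
    sup : Fin.zero ∷ half ∷ [] ⊆ fixedPoints negFin
    sup (here refl)         = ∈-fixedPoints⁺ negFin (Equivalence.from (negFin-fixed⇔ Fin.zero) (inj₁ refl))
    sup (there (here refl)) = ∈-fixedPoints⁺ negFin (Equivalence.from (negFin-fixed⇔ half)
                                (inj₂ (trans (cong₂ _+_ toℕ-half toℕ-half) (sym Q≡a+a))))

  length-fixedPoints-negFin : length (fixedPoints (negFin {Q})) ≡ 2 ∸ Q % 2
  length-fixedPoints-negFin with Q % 2 in Q%2 | m%n<n Q 2
  ... | 0           | _            = length-fixedPoints-negFin-even Q%2
  ... | 1           | _            = length-fixedPoints-negFin-odd Q%2
  ... | suc (suc _) | s≤s (s≤s ())

+≤-sub : ∀ {a b t} → a + b ℕ.≤ t → + a ≤ + t ℤ.- + b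
+≤-sub {a} {b} {t} a+b≤t = begin
  + a         ≤⟨ ℤ.+≤+ (m+n≤o⇒m≤o∸n a a+b≤t) ⟩
  + (t ∸ b)   ≡⟨ ℤₚ.⊖-≥ (m+n≤o⇒n≤o a a+b≤t) ⟨
  t ℤ.⊖ b     ≡⟨ ℤₚ.m-n≡m⊖n t b ⟨
  + t ℤ.- + b ∎
  where open ℤₚ.≤-Reasoning

sub-sub : ∀ x a b → x ℤ.- + a ℤ.- + b ≡ x ℤ.- + (a + b)
sub-sub x a b = trans (regroup x (+ a) (+ b)) (cong (λ y → x ℤ.- y) (sym (ℤₚ.pos-+ a b)))
  where
  regroup : ∀ x a b → x ℤ.- a ℤ.- b ≡ x ℤ.- (a ℤ.+ b)
  regroup = ℤ-Solver.solve-∀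

sub-add-sub : ∀ t a b b′ c → a + b′ ≡ b + c → + t ℤ.- + a ℤ.+ + b ℤ.- + b′ ≡ + t ℤ.- + c
sub-add-sub t a b b′ c eq = begin
  + t ℤ.- + a ℤ.+ + b ℤ.- + b′   ≡⟨ regroup (+ t) (+ a) (+ b) (+ b′) ⟩
  + t ℤ.- (+ a ℤ.+ + b′) ℤ.+ + b ≡⟨ cong (λ x → + t ℤ.- x ℤ.+ + b) a+b′≡b+c ⟩
  + t ℤ.- (+ b ℤ.+ + c) ℤ.+ + b  ≡⟨ cancel (+ t) (+ b) (+ c) ⟩
  + t ℤ.- + c                    ∎
  where
  open ≡-Reasoning
  a+b′≡b+c : + a ℤ.+ + b′ ≡ + b ℤ.+ + c
  a+b′≡b+c = trans (sym (ℤₚ.pos-+ a b′)) (trans (cong +_ eq) (ℤₚ.pos-+ b c))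
  regroup : ∀ t a b b′ → t ℤ.- a ℤ.+ b ℤ.- b′ ≡ t ℤ.- (a ℤ.+ b′) ℤ.+ b
  regroup = ℤ-Solver.solve-∀
  cancel : ∀ t b c → t ℤ.- (b ℤ.+ c) ℤ.+ b ≡ t ℤ.- c
  cancel = ℤ-Solver.solve-∀

sub-add : ∀ t a b c → a ≡ b + c → + t ℤ.- + a ℤ.+ + b ≡ + t ℤ.- + c
sub-add t a b c eq =
  trans (sym (ℤₚ.+-identityʳ _)) (sub-add-sub t a b 0 c (trans (+-identityʳ a) eq))

twiceBound-oddEven : ∀ t {p N} → 1 + N ≡ p → + t ℤ.- + (2 * p) ℤ.+ + 1 ≡ + t ℤ.- + (p * 1 + N * 1)
twiceBound-oddEven t {p} {N} 1+N≡p = sub-add t (2 * p) 1 (p * 1 + N * 1) fact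
  where
  fact : 2 * p ≡ 1 + (p * 1 + N * 1)
  fact rewrite sym 1+N≡p = ℕ-Solver.solve (N List.∷ List.[])

twiceBound-oddOdd : ∀ t {p N x A} → 1 + N ≡ p → A ≡ p * x →
                    + t ℤ.- + A ℤ.- + p ℤ.+ + 1 ≡ + t ℤ.- + (p * x + N * 1)
twiceBound-oddOdd t {p} {N} {x} {A} 1+N≡p A≡px =
  trans (cong (ℤ._+ + 1) (sub-sub (+ t) A p)) (sub-add t (A + p) 1 (p * x + N * 1) fact)
  where
  fact : A + p ≡ 1 + (p * x + N * 1)
  fact rewrite A≡px | sym 1+N≡p = ℕ-Solver.solve (N List.∷ x List.∷ List.[])

twiceBound-evenEven : ∀ t {p N e E} → e + N ≡ p → E ≡ e * 2 →
                      + t ℤ.- + (2 * p) ℤ.+ + E ℤ.- + e ≡ + t ℤ.- + (p * 1 + N * 1)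
twiceBound-evenEven t {p} {N} {e} {E} e+N≡p E≡2e = sub-add-sub t (2 * p) E e (p * 1 + N * 1) fact
  where
  fact : 2 * p + e ≡ E + (p * 1 + N * 1)
  fact rewrite E≡2e | sym e+N≡p = ℕ-Solver.solve (N List.∷ e List.∷ List.[])

twiceBound-evenOdd : ∀ t {p N x A e E E′} → e + N ≡ p → A ≡ p * x → E ≡ e * 4 → E′ ≡ e * 2 →
  + t ℤ.- + A ℤ.- + (2 * p) ℤ.+ + E ℤ.- + E′ ≡ + t ℤ.- + (p * x + N * 2)
twiceBound-evenOdd t {p} {N} {x} {A} {e} {E} {E′} e+N≡p A≡px E≡4e E′≡2e =
  trans (cong (λ y → y ℤ.+ + E ℤ.- + E′) (sub-sub (+ t) A (2 * p)))
    (sub-add-sub t (A + 2 * p) E E′ (p * x + N * 2) fact)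
  where
  fact : A + 2 * p + E′ ≡ E + (p * x + N * 2)
  fact rewrite A≡px | E≡4e | E′≡2e | sym e+N≡p = ℕ-Solver.solve (N List.∷ x List.∷ e List.∷ List.[])

twiceBound-closedForm : ∀ q n {c N} → c ≡ 2 ∸ q % 2 → c ^ (n / 2) + N ≡ q ^ (n / 2) →
  twiceBound q n ≡ + (q ^ n) ℤ.- + (q ^ (n / 2) * q ^ (n % 2) + N * c ^ (n % 2))
twiceBound-closedForm q n {N = N} refl eq with q % 2 | m%n<n q 2 | n % 2 | m%n<n n 2
... | 1 | _ | 0 | _ =
  twiceBound-oddEven (q ^ n) (trans (cong (_+ N) (sym (^-zeroˡ (n / 2)))) eq)
... | 1 | _ | 1 | _ =
  twiceBound-oddOdd (q ^ n) (trans (cong (_+ N) (sym (^-zeroˡ (n / 2)))) eq) (^-distribˡ-+-* q (n / 2) 1)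
... | 0 | _ | 0 | _ =
  twiceBound-evenEven (q ^ n) eq (^-distribˡ-+-* 2 (n / 2) 1)
... | 0 | _ | 1 | _ =
  twiceBound-evenOdd (q ^ n) {N = N} {e = 2 ^ (n / 2)} eq (^-distribˡ-+-* q (n / 2) 1) (^-distribˡ-+-* 2 (n / 2) 2)
    (^-distribˡ-+-* 2 (n / 2) 1)
... | suc (suc _) | s≤s (s≤s ()) | _ | _
... | _ | _ | suc (suc _) | s≤s (s≤s ())

theorem2p1 : (q n : ℕ) → 1 < q → 1 < n → (s : ℕ → Fin q) → (m : ℕ)
    → IsSOS s m n → + (2 * m) ≤ twiceBound q n
theorem2p1 zero _ () _ _ _ _
theorem2p1 q@(suc k) n _ _ s m ((_ , distinct , orientable) , special) =
  subst (+ (2 * m) ≤_)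
    (sym (twiceBound-closedForm q n (length-fixedPoints-negFin {k}) (length-unfixedVectors negFin h)))
    (+≤-sub (subst (ℕ._≤ q ^ n) (cong₂ _+_ m+m≡2m (length-symmetricWords negFin h r))
      (windows-bound s m n negFin orientable special negFin-involutive distinct h r≤1 n≡h+[r+h])))
  where
  h = n / 2
  r = n % 2
  r≤1 : r ℕ.≤ 1
  r≤1 = ℕ.s≤s⁻¹ (m%n<n n 2)
  n≡h+[r+h] : n ≡ h + (r + h)
  n≡h+[r+h] = trans (m≡m%n+[m/n]*n n 2) (regroup r h)
    where
    regroup : ∀ r h → r + h * 2 ≡ h + (r + h)
    regroup = ℕ-Solver.solve-∀
  m+m≡2m : m + m ≡ 2 * m
  m+m≡2m = cong (λ k → m + k) (sym (+-identityʳ m))
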